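{- Let $G$ be a graph with a homogeneous set $H$, let $k = \chi(G[H])$, and let $K_k$ be a clique on $k$ vertices disjoint from $G$. Let $g(G,H,K_k)$ be the graph obtained from $G$ by deleting $H$, adding $K_k$, and joining every vertex of $V(G)\setminus H$ that has a neighbour in $H$ to all vertices of $K_k$. Then (i) $\chi(G) = \chi(g(G,H,K_k))$; and (ii) if $G$ is (banner, odd hole)-free, then so is $g(G,H,K_k)$.
   Context: All graphs are finite and simple. $\chi$ denotes chromatic number. A set $H \subseteq V(G)$ is homogeneous if $2 \leq |H| < |V(G)|$ and every vertex outside $H$ is adjacent to all or to none of $H$. A hole is an induced cycle $C_k$, $k\ge4$, odd if $k$ is odd. A banner is an induced $C_4$ plus one vertex adjacent to exactly one vertex of the $C_4$. (banner, odd hole)-free means no induced subgraph isomorphic to a banner or an odd hole. -}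

module Defs where

open import Data.Nat using (ℕ; zero; suc; _≤_)
open import Data.Nat.Base using (_≡ᵇ_)
open import Data.Fin using (Fin; toℕ; _≟_)
open import Data.Bool using (Bool; true; false; not; _∧_; _∨_; T)
open import Data.List using (allFin)
open import Data.Bool.ListAction using (any)
open import Data.Product using (Σ; ∃; _×_; _,_; proj₁; proj₂)
open import Data.Sum using (_⊎_; inj₁; inj₂)
open import Relation.Nullary using (¬_; does; yes; no)
open import Relation.Binary.PropositionalEquality using (_≡_; _≢_; refl)
open import Function.Definitions using (Injective)

record Graph (V : Set) : Set where
  field
    adj    : V → V → Bool
    sym    : ∀ u v → adj u v ≡ adj v u
    irrefl : ∀ v → adj v v ≡ false
open Graph public

Colorable : {V : Set} → Graph V → ℕ → Set
Colorable {V} G k = Σ (V → Fin k) λ c → ∀ u v → adj G u v ≡ true → c u ≢ c v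

ChromaticNumber : {V : Set} → Graph V → ℕ → Set
ChromaticNumber G k = Colorable G k × (∀ j → Colorable G j → k ≤ j)

InSet : {V : Set} → (V → Bool) → V → Set
InSet h v = h v ≡ true

induced : {V : Set} → Graph V → (h : V → Bool) → Graph (Σ V (InSet h))
induced G h = record
  { adj    = λ u v → adj G (proj₁ u) (proj₁ v)
  ; sym    = λ u v → sym G (proj₁ u) (proj₁ v)
  ; irrefl = λ v → irrefl G (proj₁ v) }

-- H homogeneous: 2 ≤ |H| < |V(G)| and each vertex outside H is complete or anticomplete to H.
IsHomogeneous : {V : Set} → Graph V → (V → Bool) → Set
IsHomogeneous {V} G h =
  (Σ V λ u → Σ V λ v → u ≢ v × h u ≡ true × h v ≡ true)
  × (Σ V λ w → h w ≡ false)
  × (∀ w → h w ≡ false →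
       (∀ x → h x ≡ true → adj G w x ≡ true) ⊎ (∀ x → h x ≡ true → adj G w x ≡ false))

hasNbrIn : ∀ {n} → Graph (Fin n) → (Fin n → Bool) → Fin n → Bool
hasNbrIn {n} G h u = any (λ w → h w ∧ adj G u w) (allFin n)

cliqueAdj : ∀ {k} → Fin k → Fin k → Bool
cliqueAdj i j = not (does (i ≟ j))

private
  cliqueSym : ∀ {k} (i j : Fin k) → cliqueAdj i j ≡ cliqueAdj j i
  cliqueSym i j with i ≟ j | j ≟ i
  ... | yes _ | yes _ = refl
  ... | no _  | no _  = refl
  ... | yes refl | no ¬p = Data.Empty.⊥-elim (¬p refl)
    where import Data.Empty
  ... | no ¬p | yes refl = Data.Empty.⊥-elim (¬p refl)
    where import Data.Empty

  cliqueIrr : ∀ {k} (i : Fin k) → cliqueAdj i i ≡ false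
  cliqueIrr i with i ≟ i
  ... | yes _ = refl
  ... | no ¬p = Data.Empty.⊥-elim (¬p refl)
    where import Data.Empty

gVertex : (n : ℕ) → (Fin n → Bool) → ℕ → Set

gVertex n h k = Σ (Fin n) (λ v → h v ≡ false) ⊎ Fin k

gAdj : ∀ {n} → Graph (Fin n) → (h : Fin n → Bool) → (k : ℕ) →
       gVertex n h k → gVertex n h k → Bool
gAdj G h k (inj₁ u) (inj₁ v) = adj G (proj₁ u) (proj₁ v)
gAdj G h k (inj₁ u) (inj₂ _) = hasNbrIn G h (proj₁ u)
gAdj G h k (inj₂ _) (inj₁ v) = hasNbrIn G h (proj₁ v)
gAdj G h k (inj₂ i) (inj₂ j) = cliqueAdj i j

gGraph : ∀ {n} → Graph (Fin n) → (h : Fin n → Bool) → (k : ℕ) → Graph (gVertex n h k)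
gGraph G h k = record { adj = gAdj G h k ; sym = s ; irrefl = i }
  where
  s : ∀ u v → gAdj G h k u v ≡ gAdj G h k v u
  s (inj₁ u) (inj₁ v) = sym G (proj₁ u) (proj₁ v)
  s (inj₁ u) (inj₂ _) = refl
  s (inj₂ _) (inj₁ v) = refl
  s (inj₂ a) (inj₂ b) = cliqueSym a b
  i : ∀ v → gAdj G h k v v ≡ false
  i (inj₁ u) = irrefl G (proj₁ u)
  i (inj₂ a) = cliqueIrr a

ContainsInduced : {V : Set} → Graph V → (m : ℕ) → (Fin m → Fin m → Bool) → Set
ContainsInduced {V} G m P =
  Σ (Fin m → V) λ f → Injective _≡_ _≡_ f × (∀ a b → adj G (f a) (f b) ≡ P a b)

-- Cycle C_m on vertices 0,…,m-1 (i ~ i+1 mod m), for m ≥ 3.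
cycleAdj : (m : ℕ) → Fin m → Fin m → Bool
cycleAdj m i j =
  (toℕ j ≡ᵇ suc (toℕ i)) ∨ (toℕ i ≡ᵇ suc (toℕ j))
  ∨ ((toℕ i ≡ᵇ 0) ∧ (suc (toℕ j) ≡ᵇ m)) ∨ ((toℕ j ≡ᵇ 0) ∧ (suc (toℕ i) ≡ᵇ m))

bannerEdge : ℕ → ℕ → Bool
bannerEdge 0 1 = true
bannerEdge 1 2 = true
bannerEdge 2 3 = true
bannerEdge 3 0 = true
bannerEdge 0 4 = true
bannerEdge _ _ = false

bannerAdj : Fin 5 → Fin 5 → Bool
bannerAdj i j = bannerEdge (toℕ i) (toℕ j) ∨ bannerEdge (toℕ j) (toℕ i)

Odd : ℕ → Set
Odd m = Σ ℕ λ t → m ≡ suc (t Data.Nat.+ t)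

BannerOddHoleFree : {V : Set} → Graph V → Set
BannerOddHoleFree G =
  ¬ ContainsInduced G 5 bannerAdj
  × (∀ m → 4 ≤ m → Odd m → ¬ ContainsInduced G m (cycleAdj m))

module Submission where

-- Part (i) follows once G and g are colourable with the
-- same numbers of colours.  A colouring of g pulls back to G along the
-- homomorphism that contracts H onto K_k through an optimal colouring of G[H].
-- Conversely, a proper colouring of G uses at least k distinct colours on H
-- (the colours used on H, enumerated, recolour G[H]); give K_k k of them.  The
-- vertices of g seeing K_k are exactly those complete to H, so they avoid
-- every colour used on H.
--
-- For part (ii), the banner and every cycle of length at least 4 have no
-- adjacent twins, whereas two vertices of K_k are adjacent twins in g; hence
-- an induced banner or odd hole of g meets K_k at most once.  Sending the
-- clique to one fixed vertex of H keeps all adjacencies (by homogeneity) and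
-- yields the same induced subgraph in G.

open import Defs
open import Data.Nat using (ℕ; zero; suc; pred; _≤_; s≤s; _≡ᵇ_)
open import Data.Nat.Properties using (≡ᵇ⇒≡; ≡⇒≡ᵇ; ≤-trans; n≤1+n)
open import Data.Fin using (Fin; zero; suc; toℕ; fromℕ; inject₁; inject≤; _≟_)
open import Data.Fin.Properties using (toℕ-fromℕ; toℕ-inject₁; toℕ-inject≤; toℕ-injective; all?; any?)
open import Data.Bool using (Bool; true; false; not; _∧_; _∨_; T)
open import Data.Bool.Properties using (T-≡; T-∧; T-∨; ⇔→≡) renaming (_≟_ to _≟ᵇ_)
open import Data.List using (List; allFin; filter; length; lookup)
open import Data.List.Relation.Unary.Any as Any using ()
open import Data.List.Relation.Unary.Any.Properties using (any⁺; any⁻; lookup-index)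
open import Data.List.Relation.Unary.All as All using ()
open import Data.List.Relation.Unary.AllPairs using (_∷_)
open import Data.List.Relation.Unary.Unique.Propositional using (Unique)
open import Data.List.Relation.Unary.Unique.Propositional.Properties using (allFin⁺; filter⁺)
open import Data.List.Membership.Propositional.Properties using (∈-allFin; ∈-filter⁺; ∈-filter⁻; ∈-lookup)
open import Data.Product using (Σ; ∃; _×_; _,_; proj₁; proj₂)
open import Data.Sum using (_⊎_; inj₁; inj₂)
open import Data.Empty using (⊥-elim)
open import Relation.Nullary using (¬_; Dec; yes; no; contradiction)
open import Relation.Nullary.Decidable using (dec-true; dec-false; toWitness; ¬?; _×-dec_; _→-dec_)
open import Relation.Binary.PropositionalEquality using (_≡_; _≢_; refl; trans; cong; subst; subst₂; module ≡-Reasoning) renaming (sym to ≡-sym)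
open import Axiom.UniquenessOfIdentityProofs using (module Decidable⇒UIP)
open import Function using (_∘_)
open import Function.Bundles using (_⇔_; mk⇔; Equivalence)

open Equivalence using (to; from)

cliqueAdj-≢ : ∀ {k} {a b : Fin k} → a ≢ b → cliqueAdj a b ≡ true
cliqueAdj-≢ {a = a} {b} a≢b = cong not (dec-false (a ≟ b) a≢b)

cliqueAdj-refl : ∀ {k} (a : Fin k) → cliqueAdj a a ≡ false
cliqueAdj-refl a = cong not (dec-true (a ≟ a) refl)

cliqueAdj⇒≢ : ∀ {k} {a b : Fin k} → cliqueAdj a b ≡ true → a ≢ b
cliqueAdj⇒≢ {a = a} ab refl with trans (≡-sym ab) (cliqueAdj-refl a)
... | ()

module _ {n} (G : Graph (Fin n)) (h : Fin n → Bool) where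

  hasNbrIn-intro : ∀ {u w} → h w ≡ true → adj G u w ≡ true → hasNbrIn G h u ≡ true
  hasNbrIn-intro {u} {w} w∈H uw = to T-≡ (any⁺ _ (Any.map witness (∈-allFin w)))
    where
    witness : ∀ {x} → w ≡ x → T (h x ∧ adj G u x)
    witness refl = from T-∧ (from T-≡ w∈H , from T-≡ uw)

  hasNbrIn-elim : ∀ {u} → hasNbrIn G h u ≡ true → ∃ λ w → h w ≡ true × adj G u w ≡ true
  hasNbrIn-elim nbr with Any.satisfied (any⁻ _ (allFin n) (from T-≡ nbr))
  ... | w , found with to T-∧ found
  ...   | w∈H , uw = w , to T-≡ w∈H , to T-≡ uw

module Homogeneous {n} (G : Graph (Fin n)) (h : Fin n → Bool) (hom : IsHomogeneous G h) where

  complete-to-H : ∀ {w} → h w ≡ false → hasNbrIn G h w ≡ true → ∀ x → h x ≡ true → adj G w x ≡ true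
  complete-to-H {w} w∉H nbr with proj₂ (proj₂ hom) w w∉H | hasNbrIn-elim G h nbr
  ... | inj₁ complete     | _ = complete
  ... | inj₂ anticomplete | y , y∈H , wy with trans (≡-sym wy) (anticomplete y y∈H)
  ...   | ()

  rep : Fin n
  rep = proj₁ (proj₁ hom)

  rep∈H : h rep ≡ true
  rep∈H = proj₁ (proj₂ (proj₂ (proj₂ (proj₁ hom))))

  adj-rep : ∀ u → h u ≡ false → adj G u rep ≡ hasNbrIn G h u
  adj-rep u u∉H = ⇔→≡ (mk⇔ (hasNbrIn-intro G h rep∈H) (λ nbr → complete-to-H u∉H nbr rep rep∈H))

Homomorphism : ∀ {V W} → Graph V → Graph W → (V → W) → Set
Homomorphism F F′ φ = ∀ u v → adj F u v ≡ true → adj F′ (φ u) (φ v) ≡ true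

colorable-pullback : ∀ {V W} {F : Graph V} {F′ : Graph W} (φ : V → W) →
  Homomorphism F F′ φ → ∀ {j} → Colorable F′ j → Colorable F j
colorable-pullback φ φ-hom (c , proper) = c ∘ φ , λ u v uv → proper (φ u) (φ v) (φ-hom u v uv)

chromatic-cong : ∀ {V W} {F : Graph V} {F′ : Graph W} →
  (∀ j → Colorable F j ⇔ Colorable F′ j) → ∀ m → ChromaticNumber F m ⇔ ChromaticNumber F′ m
chromatic-cong same m = mk⇔
  (λ (col , minimal) → to (same m) col , λ j col′ → minimal j (from (same j) col′))
  (λ (col , minimal) → from (same m) col , λ j col′ → minimal j (to (same j) col′))

lookup-injective : ∀ {A : Set} {xs : List A} → Unique xs → ∀ a b → lookup xs a ≡ lookup xs b → a ≡ b
lookup-injective (_ ∷ _)      zero    zero    _  = refl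
lookup-injective (x∉xs ∷ _)   zero    (suc b) eq = contradiction eq (All.lookup x∉xs (∈-lookup b))
lookup-injective (x∉xs ∷ _)   (suc a) zero    eq = contradiction (≡-sym eq) (All.lookup x∉xs (∈-lookup a))
lookup-injective (_ ∷ unique) (suc a) (suc b) eq = cong suc (lookup-injective unique a b eq)

module Enumeration {j} {P : Fin j → Set} (P? : ∀ x → Dec (P x)) where

  members : List (Fin j)
  members = filter P? (allFin j)

  size : ℕ
  size = length members

  member : Fin size → Fin j
  member = lookup members

  member-injective : ∀ a b → member a ≡ member b → a ≡ b
  member-injective = lookup-injective (filter⁺ P? (allFin⁺ j))

  member-∈ : ∀ a → P (member a)
  member-∈ a = proj₂ (∈-filter⁻ P? {xs = allFin j} (∈-lookup {xs = members} a))

  position : ∀ {x} → P x → Fin size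
  position {x} px = Any.index (∈-filter⁺ P? (∈-allFin x) px)

  member-position : ∀ {x} (px : P x) → member (position px) ≡ x
  member-position {x} px = ≡-sym (lookup-index (∈-filter⁺ P? (∈-allFin x) px))

-- Otherwise
-- ranking the used colours would colour G[H] with fewer than k colours.

module _ {n} (G : Graph (Fin n)) (h : Fin n → Bool) where

  UsedOnH : ∀ {j} → (Fin n → Fin j) → Fin j → Set
  UsedOnH c col = ∃ λ v → h v ≡ true × c v ≡ col

  colours-used-on-H : ∀ {j k} → ChromaticNumber (induced G h) k → (col : Colorable G j) →
    Σ (Fin k → Fin j) λ ι → (∀ a b → ι a ≡ ι b → a ≡ b) × (∀ a → UsedOnH (proj₁ col) (ι a))
  colours-used-on-H {j} {k} (_ , minimal) (c , proper) = ι , ι-injective , λ a → member-∈ (inject≤ a k≤size)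
    where
    open Enumeration (λ col → any? λ v → (h v ≟ᵇ true) ×-dec (c v ≟ col))

    ranked : Colorable (induced G h) size
    ranked = (λ (v , v∈H) → position (v , v∈H , refl))
           , λ (u , u∈H) (v , v∈H) uv same → proper u v uv
               (trans (≡-sym (member-position _)) (trans (cong member same) (member-position _)))

    k≤size : k ≤ size
    k≤size = minimal size ranked

    ι : Fin k → Fin j
    ι a = member (inject≤ a k≤size)

    ι-injective : ∀ a b → ι a ≡ ι b → a ≡ b
    ι-injective a b eq = toℕ-injective (begin
      toℕ a                  ≡⟨ ≡-sym (toℕ-inject≤ a k≤size) ⟩
      toℕ (inject≤ a k≤size) ≡⟨ cong toℕ (member-injective _ _ eq) ⟩
      toℕ (inject≤ b k≤size) ≡⟨ toℕ-inject≤ b k≤size ⟩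
      toℕ b                  ∎)
      where open ≡-Reasoning

module SameColourability {n} (G : Graph (Fin n)) (h : Fin n → Bool) (hom : IsHomogeneous G h)
  (k : ℕ) (χH : ChromaticNumber (induced G h) k) where

  open Homogeneous G h hom

  κ : Σ (Fin n) (InSet h) → Fin k
  κ = proj₁ (proj₁ χH)

  -- Contract H onto K_k, sending each vertex of H to its colour under κ;
  -- the side of v is passed with its proof so that both cases can be used.
  contract-at : (v : Fin n) (side : Bool) → h v ≡ side → gVertex n h k
  contract-at v true  v∈H = inj₂ (κ (v , v∈H))
  contract-at v false v∉H = inj₁ (v , v∉H)

  contract : Fin n → gVertex n h k
  contract v = contract-at v (h v) refl

  -- Contracting H is a homomorphism from G to g, as κ is proper on G[H] and
  -- a neighbour of H outside H is joined to all of K_k.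
  contract-at-edge : ∀ u v su sv (u∈ : h u ≡ su) (v∈ : h v ≡ sv) → adj G u v ≡ true →
    gAdj G h k (contract-at u su u∈) (contract-at v sv v∈) ≡ true
  contract-at-edge u v true  true  u∈H v∈H uv = cliqueAdj-≢ (proj₂ (proj₁ χH) (u , u∈H) (v , v∈H) uv)
  contract-at-edge u v true  false u∈H _   uv = hasNbrIn-intro G h u∈H (trans (Graph.sym G v u) uv)
  contract-at-edge u v false true  _   v∈H uv = hasNbrIn-intro G h v∈H uv
  contract-at-edge u v false false _   _   uv = uv

  contract-hom : Homomorphism G (gGraph G h k) contract
  contract-hom u v = contract-at-edge u v (h u) (h v) refl refl

  expand : ∀ {j} → Colorable G j → Colorable (gGraph G h k) j
  expand {j} col@(c , proper) with colours-used-on-H G h χH col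
  ... | ι , ι-injective , ι-used = colour , colour-proper
    where

    colour : gVertex n h k → Fin j
    colour (inj₁ (w , _)) = c w
    colour (inj₂ a)       = ι a

    -- A vertex outside H seeing H is complete to H, so avoids its colours.
    avoids : ∀ {w} → h w ≡ false → hasNbrIn G h w ≡ true → ∀ a → c w ≢ ι a
    avoids {w} w∉H nbr a eq with ι-used a
    ... | x , x∈H , cx = proper w x (complete-to-H w∉H nbr x x∈H) (trans eq (≡-sym cx))

    colour-proper : ∀ x y → gAdj G h k x y ≡ true → colour x ≢ colour y
    colour-proper (inj₁ (u , _))   (inj₁ (v , _))   uv  = proper u v uv
    colour-proper (inj₁ (u , u∉H)) (inj₂ a)         nbr = avoids u∉H nbr a
    colour-proper (inj₂ a)         (inj₁ (v , v∉H)) nbr = avoids v∉H nbr a ∘ ≡-sym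
    colour-proper (inj₂ a)         (inj₂ b)         ab  = cliqueAdj⇒≢ ab ∘ ι-injective a b

  same-colourability : ∀ j → Colorable G j ⇔ Colorable (gGraph G h k) j
  same-colourability j = mk⇔ expand (colorable-pullback {F = G} {F′ = gGraph G h k} contract contract-hom)

Distinguishes : ∀ {m} → (Fin m → Fin m → Bool) → Fin m → Fin m → Fin m → Set
Distinguishes P a b c = c ≢ a × c ≢ b × P a c ≢ P b c

NoAdjacentTwins : ∀ {m} → (Fin m → Fin m → Bool) → Set
NoAdjacentTwins P = ∀ a b → P a b ≡ true → ∃ (Distinguishes P a b)

noAdjacentTwins? : ∀ {m} (P : Fin m → Fin m → Bool) → Dec (NoAdjacentTwins P)
noAdjacentTwins? P = all? λ a → all? λ b → (P a b ≟ᵇ true) →-dec any? λ c →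
  ¬? (c ≟ a) ×-dec ¬? (c ≟ b) ×-dec ¬? (P a c ≟ᵇ P b c)

banner-noAdjacentTwins : NoAdjacentTwins bannerAdj
banner-noAdjacentTwins = toWitness {a? = noAdjacentTwins? bannerAdj} _

data CycleStep (m : ℕ) : ℕ → ℕ → Set where
  next : ∀ {x} → CycleStep m x (suc x)
  wrap : ∀ {x} → suc x ≡ m → CycleStep m x 0

cycleEdge : ℕ → ℕ → ℕ → Bool
cycleEdge m x y = (y ≡ᵇ suc x) ∨ (x ≡ᵇ suc y) ∨ ((x ≡ᵇ 0) ∧ (suc y ≡ᵇ m)) ∨ ((y ≡ᵇ 0) ∧ (suc x ≡ᵇ m))

next-at : ∀ {m x y} → y ≡ suc x → CycleStep m x y
next-at refl = next

wrap-at : ∀ {m x y} → y ≡ 0 → suc x ≡ m → CycleStep m x y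
wrap-at refl = wrap

cycleEdge⇒step : ∀ {m} x y → T (cycleEdge m x y) → CycleStep m x y ⊎ CycleStep m y x
cycleEdge⇒step {m} x y edge with to T-∨ edge
... | inj₁ y≡1+x = inj₁ (next-at (≡ᵇ⇒≡ y (suc x) y≡1+x))
... | inj₂ edge′ with to T-∨ edge′
...   | inj₁ x≡1+y = inj₂ (next-at (≡ᵇ⇒≡ x (suc y) x≡1+y))
...   | inj₂ edge″ with to T-∨ edge″
...     | inj₁ wrapped = let (x≡0 , 1+y≡m) = to T-∧ wrapped in
                         inj₂ (wrap-at (≡ᵇ⇒≡ x 0 x≡0) (≡ᵇ⇒≡ (suc y) m 1+y≡m))
...     | inj₂ wrapped = let (y≡0 , 1+x≡m) = to T-∧ wrapped in
                         inj₁ (wrap-at (≡ᵇ⇒≡ y 0 y≡0) (≡ᵇ⇒≡ (suc x) m 1+x≡m))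

edge-back : ∀ {m x y} → x ≡ suc y → T (cycleEdge m x y)
edge-back {m} {x} {y} x≡1+y =
  from (T-∨ {x = y ≡ᵇ suc x}) (inj₂ (from (T-∨ {x = x ≡ᵇ suc y}) (inj₁ (≡⇒≡ᵇ x (suc y) x≡1+y))))

edge-wrap : ∀ {m x y} → x ≡ 0 → suc y ≡ m → T (cycleEdge m x y)
edge-wrap {m} {x} {y} x≡0 1+y≡m =
  from (T-∨ {x = y ≡ᵇ suc x}) (inj₂ (from (T-∨ {x = x ≡ᵇ suc y}) (inj₂
    (from (T-∨ {x = (x ≡ᵇ 0) ∧ (suc y ≡ᵇ m)}) (inj₁ (from T-∧ (≡⇒≡ᵇ x 0 x≡0 , ≡⇒≡ᵇ (suc y) m 1+y≡m)))))))

step⇒cycleEdge : ∀ {m x y} → CycleStep m y x → T (cycleEdge m x y)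
step⇒cycleEdge {m} {y = y} next = edge-back {m} {y = y} refl
step⇒cycleEdge {y = y} (wrap 1+y≡m) = edge-wrap {y = y} refl 1+y≡m

step-irrefl : ∀ {m x} → 2 ≤ m → ¬ CycleStep m x x
step-irrefl (s≤s ()) (wrap refl)

no-2-cycle : ∀ {m x y} → 3 ≤ m → CycleStep m x y → ¬ CycleStep m y x
no-2-cycle (s≤s (s≤s ())) next (wrap refl)
no-2-cycle (s≤s (s≤s ())) (wrap refl) next

no-3-cycle : ∀ {m x y z} → 4 ≤ m → CycleStep m x y → CycleStep m y z → ¬ CycleStep m z x
no-3-cycle (s≤s (s≤s (s≤s ()))) next        next        (wrap refl)
no-3-cycle (s≤s (s≤s (s≤s ()))) next        (wrap refl) next
no-3-cycle (s≤s (s≤s (s≤s ()))) (wrap refl) next        next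

step-injectiveˡ : ∀ {m x y z} → CycleStep m x z → CycleStep m y z → x ≡ y
step-injectiveˡ next        next     = refl
step-injectiveˡ (wrap refl) (wrap e) = cong pred (≡-sym e)

predecessor : ∀ {m} (a : Fin m) → Σ (Fin m) λ c → CycleStep m (toℕ c) (toℕ a)
predecessor {suc m} zero    = fromℕ m , wrap (cong suc (toℕ-fromℕ m))
predecessor {suc m} (suc a) = inject₁ a , subst (λ x → CycleStep (suc m) x (suc (toℕ a))) (≡-sym (toℕ-inject₁ a)) next

predecessor-distinguishes : ∀ {m} → 4 ≤ m → ∀ {a b : Fin m} →
  CycleStep m (toℕ a) (toℕ b) → ∃ (Distinguishes (cycleAdj m) a b)
predecessor-distinguishes {m} 4≤m {a} {b} a→b with predecessor a
... | c , c→a = c , c≢a , c≢b , differ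
  where
  3≤m : 3 ≤ m
  3≤m = ≤-trans (n≤1+n 3) 4≤m

  c≢a : c ≢ a
  c≢a refl = step-irrefl (≤-trans (n≤1+n 2) 3≤m) c→a

  c≢b : c ≢ b
  c≢b refl = no-2-cycle 3≤m a→b c→a

  ac : cycleAdj m a c ≡ true
  ac = to T-≡ (step⇒cycleEdge {m} {toℕ a} {toℕ c} c→a)

  -- c ~ a; if also c ~ b then b → c closes a triangle, and c → b makes c = a.
  differ : cycleAdj m a c ≢ cycleAdj m b c
  differ same with cycleEdge⇒step {m} (toℕ b) (toℕ c) (from T-≡ (trans (≡-sym same) ac))
  ... | inj₁ b→c = no-3-cycle 4≤m c→a a→b b→c
  ... | inj₂ c→b = c≢a (toℕ-injective (step-injectiveˡ c→b a→b))

cycle-noAdjacentTwins : ∀ m → 4 ≤ m → NoAdjacentTwins (cycleAdj m)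
cycle-noAdjacentTwins m 4≤m a b ab with cycleEdge⇒step {m} (toℕ a) (toℕ b) (from T-≡ ab)
... | inj₁ a→b = predecessor-distinguishes 4≤m a→b
... | inj₂ b→a with predecessor-distinguishes 4≤m b→a
...   | c , c≢b , c≢a , differ = c , c≢a , c≢b , differ ∘ ≡-sym

AdjacentTwins : ∀ {V} → Graph V → V → V → Set
AdjacentTwins F x y = adj F x y ≡ true × (∀ z → z ≢ x → z ≢ y → adj F x z ≡ adj F y z)

copy-avoids-twins : ∀ {V} {F : Graph V} {m P} → NoAdjacentTwins P → (copy : ContainsInduced F m P) →
  ∀ a b → ¬ AdjacentTwins F (proj₁ copy a) (proj₁ copy b)
copy-avoids-twins {F = F} {P = P} noTwins (f , f-injective , f-induced) a b (fafb , same)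
  with noTwins a b (trans (≡-sym (f-induced a b)) fafb)
... | c , c≢a , c≢b , differ = differ (begin
  P a c               ≡⟨ ≡-sym (f-induced a c) ⟩
  adj F (f a) (f c)   ≡⟨ same (f c) (c≢a ∘ f-injective) (c≢b ∘ f-injective) ⟩
  adj F (f b) (f c)   ≡⟨ f-induced b c ⟩
  P b c               ∎)
  where open ≡-Reasoning

module CopyTransfer {n} (G : Graph (Fin n)) (h : Fin n → Bool) (hom : IsHomogeneous G h) (k : ℕ) where

  open Homogeneous G h hom

  clique-twins : ∀ {a b : Fin k} → a ≢ b → AdjacentTwins (gGraph G h k) (inj₂ a) (inj₂ b)
  clique-twins {a} {b} a≢b = cliqueAdj-≢ a≢b , same-neighbours
    where
    same-neighbours : ∀ z → z ≢ inj₂ a → z ≢ inj₂ b → gAdj G h k (inj₂ a) z ≡ gAdj G h k (inj₂ b) z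
    same-neighbours (inj₁ _) _   _   = refl
    same-neighbours (inj₂ c) c≢a c≢b =
      trans (cliqueAdj-≢ (c≢a ∘ cong inj₂ ∘ ≡-sym)) (≡-sym (cliqueAdj-≢ (c≢b ∘ cong inj₂ ∘ ≡-sym)))

  restore : gVertex n h k → Fin n
  restore (inj₁ (v , _)) = v
  restore (inj₂ _)       = rep

  -- restore is faithful on pairs containing at most one clique vertex.
  AtMostOneClique : gVertex n h k → gVertex n h k → Set
  AtMostOneClique x y = ∀ {a b} → x ≡ inj₂ a → y ≡ inj₂ b → a ≡ b

  restore-adj : ∀ x y → AtMostOneClique x y → adj G (restore x) (restore y) ≡ gAdj G h k x y
  restore-adj (inj₁ _)         (inj₁ _)         _ = refl
  restore-adj (inj₁ (u , u∉H)) (inj₂ _)         _ = adj-rep u u∉H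
  restore-adj (inj₂ _)         (inj₁ (v , v∉H)) _ = trans (Graph.sym G rep v) (adj-rep v v∉H)
  restore-adj (inj₂ a)         (inj₂ b)         one with one refl refl
  ... | refl = trans (Graph.irrefl G rep) (≡-sym (cliqueAdj-refl a))

  restore-injective : ∀ x y → AtMostOneClique x y → restore x ≡ restore y → x ≡ y
  restore-injective (inj₁ (u , u∉H)) (inj₁ (v , v∉H)) _ refl =
    cong (λ p → inj₁ (u , p)) (Decidable⇒UIP.≡-irrelevant _≟ᵇ_ u∉H v∉H)
  restore-injective (inj₁ (u , u∉H)) (inj₂ _) _ refl with trans (≡-sym u∉H) rep∈H
  ... | ()
  restore-injective (inj₂ _) (inj₁ (v , v∉H)) _ refl with trans (≡-sym v∉H) rep∈H
  ... | ()
  restore-injective (inj₂ a) (inj₂ b) one _ = cong inj₂ (one refl refl)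

  -- An induced copy of a twin-free pattern in g meets K_k at most once, so
  -- restore turns it into an induced copy in G.
  copy-transfer : ∀ {m P} → NoAdjacentTwins P → ContainsInduced (gGraph G h k) m P → ContainsInduced G m P
  copy-transfer noTwins copy@(f , f-injective , f-induced) =
    restore ∘ f ,
    (λ {a} {b} eq → f-injective (restore-injective (f a) (f b) (one a b) eq)) ,
    λ a b → trans (restore-adj (f a) (f b) (one a b)) (f-induced a b)
    where
    one : ∀ a b → AtMostOneClique (f a) (f b)
    one a b {i} {j} fa fb with i ≟ j
    ... | yes i≡j = i≡j
    ... | no i≢j  = ⊥-elim (copy-avoids-twins {F = gGraph G h k} noTwins copy a b
                      (subst₂ (AdjacentTwins (gGraph G h k)) (≡-sym fa) (≡-sym fb) (clique-twins i≢j)))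

  bannerOddHoleFree-transfer : BannerOddHoleFree G → BannerOddHoleFree (gGraph G h k)
  bannerOddHoleFree-transfer (noBanner , noOddHole) =
    noBanner ∘ copy-transfer banner-noAdjacentTwins ,
    λ m 4≤m odd → noOddHole m 4≤m odd ∘ copy-transfer (cycle-noAdjacentTwins m 4≤m)

mainTheorem6 : ∀ {n} (G : Graph (Fin n)) (h : Fin n → Bool) → IsHomogeneous G h →
    (k : ℕ) → ChromaticNumber (induced G h) k →
    (∀ m → ChromaticNumber G m ⇔ ChromaticNumber (gGraph G h k) m)
    × (BannerOddHoleFree G → BannerOddHoleFree (gGraph G h k))
mainTheorem6 G h hom k χH =
  chromatic-cong {F = G} {F′ = gGraph G h k} (SameColourability.same-colourability G h hom k χH) ,
  CopyTransfer.bannerOddHoleFree-transfer G h hom k
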